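{- Let $G'$ be an antipodal partial cube of rank $r$, and let $G$ be an affine partial cube which is a halfspace of $G'$. Then $G$ has rank at most $r-1$.
   Context: A partial cube is a finite graph isometrically embedded in a hypercube $Q_n$ (vertex set $\{+,-\}^n$, adjacency meaning the vectors differ in one coordinate), with $n$ minimal. For a coordinate $e$, the $\Theta$-class $E_e$ consists of the edges whose endpoints differ in coordinate $e$. The halfspaces $E_e^+$ and $E_e^-$ are the induced subgraphs on the vertices with $e$-th coordinate $+$ and $-$, respectively. A partial cube is antipodal if it contains, with each vertex, the vertex with all coordinates flipped. A partial cube is affine if it is (isomorphic to) a halfspace of an antipodal partial cube. The contraction along $E_e$ identifies the endpoints of all edges of $E_e$. The rank is the largest $r$ such that $Q_r$ is obtained from the graph by a sequence of contractions. -}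

module Defs where

open import Data.Nat using (ℕ; zero; suc; _≤_; _+_)
open import Data.Bool using (Bool; true; false; not; _≟_)
open import Data.Fin using (Fin)
open import Data.Vec using (Vec; []; _∷_; map; lookup; insertAt)
open import Data.Product using (Σ; ∃; _×_)
open import Relation.Nullary using (yes; no)
open import Relation.Binary.PropositionalEquality using (_≡_)

-- Vertices of the hypercube Q_n are sign vectors in {+,-}^n,
-- encoded as Vec Bool n (true = +, false = -).
Vertex : ℕ → Set
Vertex n = Vec Bool n

-- A (vertex set of an induced) subgraph of Q_n: a predicate on vertices.
VSet : ℕ → Set₁
VSet n = Vertex n → Set

ham : ∀ {n} → Vertex n → Vertex n → ℕ
ham []       []       = 0
ham (x ∷ xs) (y ∷ ys) with x ≟ y
... | yes _ = ham xs ys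
... | no  _ = suc (ham xs ys)

Adj : ∀ {n} → Vertex n → Vertex n → Set
Adj u v = ham u v ≡ 1

data Walk {n : ℕ} (V : VSet n) : Vertex n → Vertex n → ℕ → Set where
  here : ∀ {u} → V u → Walk V u u 0
  step : ∀ {u w v k} → V u → Adj u w → Walk V w v k → Walk V u v (suc k)

GraphDist : ∀ {n} → VSet n → Vertex n → Vertex n → ℕ → Set
GraphDist V u v k = Walk V u v k × (∀ j → Walk V u v j → k ≤ j)

Isometric : ∀ {n} → VSet n → Set
Isometric V = ∀ u v → V u → V v → GraphDist V u v (ham u v)

MinimalDim : ∀ {n} → VSet n → Set
MinimalDim {n} V =
  ∀ m (f : Vertex n → Vertex m) →
  (∀ u v k → V u → V v → GraphDist V u v k → ham (f u) (f v) ≡ k) →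
  n ≤ m

PartialCube : ∀ {n} → VSet n → Set
PartialCube V = (∃ λ v → V v) × Isometric V × MinimalDim V

Antipodal : ∀ {n} → VSet n → Set
Antipodal V = ∀ v → V v → V (map not v)

Halfspace : ∀ {n} → VSet n → Fin n → Bool → VSet n
Halfspace V e s v = V v × lookup v e ≡ s

-- Contraction along the Θ-class of coordinate e (identifying the endpoints
-- of all edges differing in coordinate e) = deleting coordinate e.
Contraction : ∀ {n} → Fin (suc n) → VSet (suc n) → VSet n
Contraction e V w = ∃ λ b → V (insertAt w e b)

data ContractsTo : (n : ℕ) → VSet n → ℕ → Set₁ where
  full     : ∀ {n} {V : VSet n} → (∀ v → V v) → ContractsTo n V n
  contract : ∀ {n m} {V : VSet (suc n)} (e : Fin (suc n)) →
             ContractsTo n (Contraction e V) m → ContractsTo (suc n) V m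

IsRank : ∀ {n} → VSet n → ℕ → Set₁
IsRank {n} V r = ContractsTo n V r × (∀ m → ContractsTo n V m → m ≤ r)

-- Contract G' along the same sequence as the halfspace E_e^s, except that the
-- contraction of e itself (which the sequence must perform, E_e^s being no
-- cube in coordinate e) is skipped.  Every vertex of E_e^s lies in G' together
-- with its antipode, and this pair survives each contraction, so once the
-- halfspace has become Q_m both sides e = s and e ≠ s of the contracted G' are
-- full: G' contracts to Q_(m+1).
module Submission where

open import Defs
open import Data.Nat using (ℕ; _<_; suc)
open import Data.Bool using (Bool; not) renaming (_≟_ to _≟ᵇ_)
open import Data.Bool.Properties using (not-involutive; not-¬; ¬-not)
open import Data.Fin using (Fin; punchIn; punchOut; pinch) renaming (zero to fzero; suc to fsuc)
open import Data.Fin.Properties using (punchIn-punchOut; _≟_)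
open import Data.Vec using (Vec; _∷_; map; lookup; insertAt; removeAt; replicate)
open import Data.Vec.Properties
  using (map-∘; map-cong; map-id; map-insertAt; insertAt-lookup; insertAt-punchIn; insertAt-removeAt; lookup-replicate)
open import Data.Product using (_,_; proj₁; proj₂)
open import Data.Empty using (⊥-elim)
open import Relation.Nullary using (¬_; yes; no)
open import Relation.Unary using (_⊆_; _∩_; _⊢_; Universal)
open import Relation.Binary.PropositionalEquality

private
  variable
    A : Set
    n k m : ℕ

map-not-involutive : (v : Vec Bool n) → map not (map not v) ≡ v
map-not-involutive v = begin
  map not (map not v)       ≡⟨ map-∘ not not v ⟨
  map (λ b → not (not b)) v ≡⟨ map-cong not-involutive v ⟩
  map (λ b → b) v           ≡⟨ map-id v ⟩
  v                         ∎
  where open ≡-Reasoning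

insertAt-insertAt : (w : Vec A n) (i : Fin (suc n)) (e : Fin (suc (suc n))) (b c : A) →
  insertAt (insertAt w i b) e c ≡ insertAt (insertAt w (pinch i e) c) (punchIn e i) b
insertAt-insertAt w       i        fzero    b c = refl
insertAt-insertAt w       fzero    (fsuc e) b c = refl
insertAt-insertAt (x ∷ w) (fsuc i) (fsuc e) b c = cong (x ∷_) (insertAt-insertAt w i e b c)

Antipodes : VSet n → VSet n
Antipodes V = map not ⊢ V

AntipodalCore : VSet n → VSet n
AntipodalCore V = V ∩ Antipodes V

Slice : VSet (suc n) → Fin (suc n) → Bool → VSet n
Slice V e s = (λ w → insertAt w e s) ⊢ V

halfspace-mono : {V W : VSet n} {e : Fin n} {s : Bool} → V ⊆ W → Halfspace V e s ⊆ Halfspace W e s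
halfspace-mono V⊆W (v , ve≡s) = V⊆W v , ve≡s

contraction-mono : {V W : VSet (suc n)} {i : Fin (suc n)} → V ⊆ W → Contraction i V ⊆ Contraction i W
contraction-mono V⊆W (b , v) = b , V⊆W v

contraction-antipodalCore : {V : VSet (suc n)} {i : Fin (suc n)} →
  Contraction i (AntipodalCore V) ⊆ AntipodalCore (Contraction i V)
contraction-antipodalCore {V = V} {i} {w} (b , v , v̄) =
  (b , v) , (not b , subst V (map-insertAt not b w i) v̄)

contraction-slice : {V : VSet (suc (suc n))} {e : Fin (suc (suc n))} {s : Bool} {i : Fin (suc n)} →
  Contraction i (Slice V e s) ⊆ Slice (Contraction (punchIn e i) V) (pinch i e) s
contraction-slice {V = V} {e} {s} {i} {w} (b , v) = b , subst V (insertAt-insertAt w i e b s) v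

contraction-halfspace-self : {V : VSet (suc n)} {e : Fin (suc n)} {s : Bool} →
  Contraction e (Halfspace V e s) ⊆ Slice V e s
contraction-halfspace-self {V = V} {e} {s} {w} (b , v , ve≡s) =
  subst (λ c → V (insertAt w e c)) (trans (sym (insertAt-lookup w e b)) ve≡s) v

contraction-halfspace-other : {V : VSet (suc n)} {i e : Fin (suc n)} {s : Bool} (i≢e : i ≢ e) →
  Contraction i (Halfspace V e s) ⊆ Halfspace (Contraction i V) (punchOut i≢e) s
contraction-halfspace-other {i = i} {e} {s} i≢e {w} (b , v , ve≡s) = (b , v) , (begin
  lookup w (punchOut i≢e)                            ≡⟨ insertAt-punchIn w i b (punchOut i≢e) ⟨
  lookup (insertAt w i b) (punchIn i (punchOut i≢e)) ≡⟨ cong (lookup (insertAt w i b)) (punchIn-punchOut i≢e) ⟩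
  lookup (insertAt w i b) e                          ≡⟨ ve≡s ⟩
  s                                                  ∎)
  where open ≡-Reasoning

halfspace-nonuniversal : {V : VSet n} {e : Fin n} {s : Bool} → ¬ Universal (Halfspace V e s)
halfspace-nonuniversal {e = e} {s} all =
  not-¬ refl (sym (trans (sym (lookup-replicate e (not s))) (proj₂ (all (replicate _ (not s))))))

-- A vertex off the slice is the antipode of one on it.
universal-slice-antipodalCore : {V : VSet (suc n)} {e : Fin (suc n)} {s : Bool} →
  Universal (Slice (AntipodalCore V) e s) → Universal V
universal-slice-antipodalCore {V = V} {e} {s} all v =
  subst V (insertAt-removeAt v e) (fill (removeAt v e) (lookup v e))
  where
  fill : ∀ w b → V (insertAt w e b)
  fill w b with b ≟ᵇ s
  ... | yes refl = proj₁ (all w)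
  ... | no b≢s   = subst V (trans (map-insertAt not s (map not w) e)
                                  (cong₂ (λ x y → insertAt x e y) (map-not-involutive w) (sym (¬-not b≢s))))
                           (proj₂ (all (map not w)))

contractsTo-from-slice : {K : VSet k} {V : VSet (suc k)} (e : Fin (suc k)) (s : Bool) →
  K ⊆ Slice (AntipodalCore V) e s → ContractsTo k K m → ContractsTo (suc k) V (suc m)
contractsTo-from-slice e s K⊆ (full all) = full (universal-slice-antipodalCore λ w → K⊆ (all w))
contractsTo-from-slice {K = K} {V} e s K⊆ (contract i c) =
  contract (punchIn e i) (contractsTo-from-slice (pinch i e) s contracted⊆ c)
  where
  contracted⊆ : Contraction i K ⊆ Slice (AntipodalCore (Contraction (punchIn e i) V)) (pinch i e) s
  contracted⊆ k = contraction-antipodalCore {V = V}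
    (contraction-slice {V = AntipodalCore V} (contraction-mono {V = K} {i = i} K⊆ k))

contractsTo-from-halfspace : {K V : VSet n} (e : Fin n) (s : Bool) →
  K ⊆ Halfspace (AntipodalCore V) e s → ContractsTo n K m → ContractsTo n V (suc m)
contractsTo-from-halfspace e s K⊆ (full all) = ⊥-elim (halfspace-nonuniversal λ v → K⊆ (all v))
contractsTo-from-halfspace {K = K} {V} e s K⊆ (contract i c) with i ≟ e
... | yes refl = contractsTo-from-slice i s contracted⊆ c
  where
  contracted⊆ : Contraction i K ⊆ Slice (AntipodalCore V) i s
  contracted⊆ k = contraction-halfspace-self {V = AntipodalCore V} (contraction-mono {V = K} {i = i} K⊆ k)
... | no i≢e   = contract i (contractsTo-from-halfspace (punchOut i≢e) s contracted⊆ c)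
  where
  contracted⊆ : Contraction i K ⊆ Halfspace (AntipodalCore (Contraction i V)) (punchOut i≢e) s
  contracted⊆ k = halfspace-mono {V = Contraction i (AntipodalCore V)} (contraction-antipodalCore {V = V})
    (contraction-halfspace-other {V = AntipodalCore V} i≢e (contraction-mono {V = K} {i = i} K⊆ k))

lemma32 : ∀ {n} (G' : VSet n) (r : ℕ) →
    PartialCube G' → Antipodal G' → IsRank G' r →
    (e : Fin n) (s : Bool) →
    ∀ m → IsRank (Halfspace G' e s) m → m < r
lemma32 G' r _ antipodal (_ , maximal) e s m (halfspaceContracts , _) =
  maximal (suc m) (contractsTo-from-halfspace e s inCore halfspaceContracts)
  where
  inCore : Halfspace G' e s ⊆ Halfspace (AntipodalCore G') e s
  inCore (g , ge≡s) = (g , antipodal _ g) , ge≡s
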